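{- Let $n\ge1$, $I=\{i_1<\dots<i_l\}\subseteq\{0,\dots,n-1\}$, $i_{l+1}=n$, $j_k=i_{k+1}-i_k$, and let $i_m$ ($m\in\{1,\dots,l\}$) be the greatest element of $I$ such that $j_m$ is odd. Suppose $n-i_m$ is odd and $w\in(C_n^{I^c})_{i_m}$. Define $u\in B_n$ by $u(i_m+1)=-w(i_m+1)$ and $u(i)=w(i)$ for all $i\in\{1,\dots,n\}\setminus\{i_m+1\}$. Then $L(u)+i_m+1=L(w)$.
   Context: $B_n$ is the group of bijections $w$ of $\{ -n,\dots,n\}$ with $w(-i)=-w(i)$. $D(w)=\{i\in\{0,\dots,n-1\}:w(i)>w(i+1)\}$ with $w(0)=0$. $L(w)=\frac12|\{(i,j)\in\{ -n,\dots,n\}^2:i<j,\ w(i)>w(j),\ i\not\equiv j\pmod 2\}|$. $C_n=\{w\in B_n:|w(j)|\equiv j\pmod2\ \forall j\}$, $C_n^{I^c}=\{w\in C_n:D(w)\subseteq I\}$, and for $k\in\{0,\dots,n\}$, $(C_n^{I^c})_k$ is the set of $w\in C_n^{I^c}$ with $w(k)=n$ or $w(k+1)=-n$. -}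

module Defs where

open import Data.Nat as ℕ using (ℕ; zero; suc; _%_; _/_)
open import Data.Integer as ℤ using (ℤ; +_; -_; ∣_∣; _-_)
open import Data.List using (List; upTo; map; filter; length; concatMap)
open import Data.Product using (_×_; _,_; Σ)
open import Data.Sum using (_⊎_)
open import Data.Bool using (if_then_else_)
open import Relation.Nullary using (¬_; Dec)
open import Relation.Nullary.Decidable using (_×-dec_; ¬?)
open import Relation.Binary.PropositionalEquality using (_≡_)

InRange : ℕ → ℤ → Set
InRange n i = (- (+ n)) ℤ.≤ i × i ℤ.≤ + n

-- B_n : w : ℤ → ℤ (only its values on [-n,n] matter) with w(-i) = -w(i),
-- mapping [-n,n] bijectively onto [-n,n].
IsB : ℕ → (ℤ → ℤ) → Set
IsB n w =
    (∀ i → w (- i) ≡ - w i)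
  × (∀ i → InRange n i → InRange n (w i))
  × (∀ i j → InRange n i → InRange n j → w i ≡ w j → i ≡ j)
  × (∀ k → InRange n k → Σ ℤ λ i → InRange n i × w i ≡ k)

IsC : ℕ → (ℤ → ℤ) → Set
IsC n w = IsB n w × (∀ j → InRange n j → ∣ w j ∣ % 2 ≡ ∣ j ∣ % 2)

-- D(w) ⊆ I, where D(w) = {i ∈ {0..n-1} : w(i) > w(i+1)} (w(0)=0 by oddness).
DescIn : ℕ → (ℕ → Set) → (ℤ → ℤ) → Set
DescIn n I w = ∀ i → i ℕ.< n → w (+ suc i) ℤ.< w (+ i) → I i

IsCI : ℕ → (ℕ → Set) → (ℤ → ℤ) → Set
IsCI n I w = IsC n w × DescIn n I w

IsCIk : ℕ → (ℕ → Set) → ℕ → (ℤ → ℤ) → Set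
IsCIk n I k w = IsCI n I w × (w (+ k) ≡ + n ⊎ w (+ suc k) ≡ - (+ n))

range : ℕ → List ℤ
range n = map (λ k → (+ k) - (+ n)) (upTo (suc (2 ℕ.* n)))

invPairs : ℕ → (ℤ → ℤ) → List (ℤ × ℤ)
invPairs n w =
  filter (λ p → let i = Data.Product.proj₁ p ; j = Data.Product.proj₂ p in
                 (i ℤ.<? j) ×-dec ((w j ℤ.<? w i) ×-dec (∣ i - j ∣ % 2 ℕ.≟ 1)))
         (concatMap (λ i → map (λ j → (i , j)) (range n)) (range n))
  where import Data.Product

L : ℕ → (ℤ → ℤ) → ℕ
L n w = length (invPairs n w) / 2

Succ : ℕ → (ℕ → Set) → ℕ → ℕ → Set
Succ n I a b = a ℕ.< b × (I b ⊎ b ≡ n) × (∀ c → a ℕ.< c → c ℕ.< b → ¬ I c)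

IsIm : ℕ → (ℕ → Set) → ℕ → Set
IsIm n I im =
    I im
  × (∀ b → Succ n I im b → (b ℕ.∸ im) % 2 ≡ 1)
  × (∀ a b → I a → im ℕ.< a → Succ n I a b → (b ℕ.∸ a) % 2 ≡ 0)

-- u: u(±k) = -w(±k), all other values equal to w (i.e. u(k) = -w(k), u(i)=w(i) else on 1..n,
-- extended to B_n by oddness).
flipAt : ℕ → (ℤ → ℤ) → ℤ → ℤ
flipAt k w i = if ∣ i ∣ ℕ.≡ᵇ k then - w i else w i

-- Put p = i_m + 1 and n = p + 2b.  Since n − i_m is odd, w(i_m) = n would give
-- |w(i_m)| ≢ i_m (mod 2), so w(p) = −n and w(−p) = n; u is w with the values at p
-- and −p exchanged.  Among pairs i < j of opposite parity only those meeting ±p can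
-- change status, and there the extreme values decide: u gains every pair (p, j)
-- and (i, −p) while losing every pair (−p, j) and (i, p).  Counting opposite-parity
-- partners in [−n, n] gives b + b pairs of the first kind and (p + b) + (p + b) of
-- the second, so the inversion list of w has 2p more elements than that of u.

module Submission where

open import Defs
open import Data.Nat using (ℕ; suc; _+_; _≤_; _<_; _∸_; _%_)
open import Data.Integer using (ℤ)
open import Relation.Binary.PropositionalEquality using (_≡_)

open import Level using (0ℓ)
open import Function using (_∘_; case_of_; mk⇔)
open import Data.Bool using (Bool; true; false; _∧_; if_then_else_)
open import Data.Bool.Properties using (∧-zeroʳ; ∧-identityʳ)
open import Data.Empty using (⊥-elim)
open import Data.Product using (_×_; _,_; proj₁; proj₂)
open import Data.Sum using (inj₁; inj₂)
open import Data.List using (List; []; _∷_; _++_; map; filter; length; concatMap; applyUpTo; upTo)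
open import Data.List.Properties using (map-++; map-cong)
open import Data.Nat as ℕ using (zero; _*_; _/_; _<ᵇ_; _≡ᵇ_; z≤n; s≤s; z<s; s<s)
open import Data.Nat.Properties
open import Data.Nat.DivMod using (m≡m%n+[m/n]*n; [m+kn]%n≡m%n; +-distrib-/-∣ʳ; m*n/n≡m)
open import Data.Nat.Divisibility using (divides)
open import Data.Nat.ListAction using (sum)
open import Data.Nat.ListAction.Properties using (sum-++)
open import Data.Nat.Tactic.RingSolver using (solve-∀)
open import Data.Integer as ℤ using (+_; -[1+_]; -_; ∣_∣; _-_; _⊖_)
import Data.Integer.Properties as ℤₚ
import Data.Integer.Tactic.RingSolver as ℤ-Solver
open import Relation.Binary.Definitions using (tri<; tri≈; tri>)
open import Relation.Binary.PropositionalEquality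
  using (refl; sym; trans; cong; cong₂; subst; subst₂; _≢_; module ≡-Reasoning)
open import Relation.Nullary using (¬_; Dec; does; yes; no)
open import Relation.Nullary.Decidable using (dec-true; dec-false; does-⇔)
open import Relation.Unary using (Pred; Decidable)

open ≡-Reasoning

𝟙 : Bool → ℕ
𝟙 true  = 1
𝟙 false = 0

𝟙-guarded : ∀ x y d d′ (c c′ : ℕ) → (x ≡ true → y ≡ true → 𝟙 d + c ≡ 𝟙 d′ + c′) →
  𝟙 (x ∧ (d ∧ y)) + c * 𝟙 (x ∧ y) ≡ 𝟙 (x ∧ (d′ ∧ y)) + c′ * 𝟙 (x ∧ y)
𝟙-guarded false y     d d′ c c′ _ = trans (*-zeroʳ c) (sym (*-zeroʳ c′))
𝟙-guarded true  false d d′ c c′ _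
  rewrite ∧-zeroʳ d | ∧-zeroʳ d′ = trans (*-zeroʳ c) (sym (*-zeroʳ c′))
𝟙-guarded true  true  d d′ c c′ eq
  rewrite ∧-identityʳ d | ∧-identityʳ d′ | *-identityʳ c | *-identityʳ c′ = eq refl refl

Σ< : ℕ → (ℕ → ℕ) → ℕ
Σ< zero    f = 0
Σ< (suc N) f = f 0 + Σ< N (f ∘ suc)

Σ<-cong : ∀ N {f g : ℕ → ℕ} → (∀ k → k < N → f k ≡ g k) → Σ< N f ≡ Σ< N g
Σ<-cong zero    eq = refl
Σ<-cong (suc N) eq = cong₂ _+_ (eq 0 z<s) (Σ<-cong N (λ k k<N → eq (suc k) (s<s k<N)))

Σ<-zero : ∀ N → Σ< N (λ _ → 0) ≡ 0
Σ<-zero zero    = refl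
Σ<-zero (suc N) = Σ<-zero N

Σ<-distrib-+ : ∀ N (f g : ℕ → ℕ) → Σ< N (λ k → f k + g k) ≡ Σ< N f + Σ< N g
Σ<-distrib-+ zero    f g = refl
Σ<-distrib-+ (suc N) f g =
  trans (cong (_+_ (f 0 + g 0)) (Σ<-distrib-+ N (f ∘ suc) (g ∘ suc))) (interchange (f 0) (g 0) _ _)
  where
  interchange : ∀ a b c d → a + b + (c + d) ≡ a + c + (b + d)
  interchange = solve-∀

Σ<-*ˡ : ∀ N c (f : ℕ → ℕ) → Σ< N (λ k → c * f k) ≡ c * Σ< N f
Σ<-*ˡ zero    c f = sym (*-zeroʳ c)
Σ<-*ˡ (suc N) c f = trans (cong (_+_ (c * f 0)) (Σ<-*ˡ N c (f ∘ suc))) (sym (*-distribˡ-+ c (f 0) _))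

Σ<-pick : ∀ {N t} → t < N → (f : ℕ → ℕ) → Σ< N (λ k → 𝟙 (k ≡ᵇ t) * f k) ≡ f t
Σ<-pick {suc N} {zero}  _         f = trans (cong₂ _+_ (+-identityʳ (f 0)) (Σ<-zero N)) (+-identityʳ (f 0))
Σ<-pick {suc N} {suc t} (s<s t<N) f = Σ<-pick t<N (f ∘ suc)

Σ<-restrict : ∀ {M N} → M ≤ N → (b : ℕ → Bool) →
  Σ< N (λ k → 𝟙 ((k <ᵇ M) ∧ b k)) ≡ Σ< M (𝟙 ∘ b)
Σ<-restrict {zero}  {N}     _         b = Σ<-zero N
Σ<-restrict {suc M} {suc N} (s≤s M≤N) b = cong (_+_ (𝟙 (b 0))) (Σ<-restrict M≤N (b ∘ suc))

ΣΣ : ℕ → (ℕ → ℕ → ℕ) → ℕ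
ΣΣ N f = Σ< N (λ k → Σ< N (f k))

ΣΣ-cong : ∀ N {f g : ℕ → ℕ → ℕ} → (∀ k l → k < N → l < N → f k l ≡ g k l) → ΣΣ N f ≡ ΣΣ N g
ΣΣ-cong N eq = Σ<-cong N (λ k k<N → Σ<-cong N (λ l l<N → eq k l k<N l<N))

ΣΣ-distrib-+ : ∀ N (f g : ℕ → ℕ → ℕ) → ΣΣ N (λ k l → f k l + g k l) ≡ ΣΣ N f + ΣΣ N g
ΣΣ-distrib-+ N f g = trans (Σ<-cong N (λ k _ → Σ<-distrib-+ N (f k) (g k)))
                           (Σ<-distrib-+ N (λ k → Σ< N (f k)) (λ k → Σ< N (g k)))

ΣΣ-pick-row : ∀ {N t} → t < N → (f : ℕ → ℕ → ℕ) →
  ΣΣ N (λ k l → 𝟙 (k ≡ᵇ t) * f k l) ≡ Σ< N (f t)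
ΣΣ-pick-row {N} {t} t<N f =
  trans (Σ<-cong N (λ k _ → Σ<-*ˡ N (𝟙 (k ≡ᵇ t)) (f k))) (Σ<-pick t<N (λ k → Σ< N (f k)))

ΣΣ-pick-column : ∀ {N t} → t < N → (f : ℕ → ℕ → ℕ) →
  ΣΣ N (λ k l → 𝟙 (l ≡ᵇ t) * f k l) ≡ Σ< N (λ k → f k t)
ΣΣ-pick-column {N} t<N f = Σ<-cong N (λ k _ → Σ<-pick t<N (f k))

ΣΣ-row+column : ∀ {N s t} → s < N → t < N → (f : ℕ → ℕ → ℕ) →
  ΣΣ N (λ k l → (𝟙 (k ≡ᵇ s) + 𝟙 (l ≡ᵇ t)) * f k l) ≡ Σ< N (f s) + Σ< N (λ k → f k t)
ΣΣ-row+column {N} {s} {t} s<N t<N f = begin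
    ΣΣ N (λ k l → (𝟙 (k ≡ᵇ s) + 𝟙 (l ≡ᵇ t)) * f k l)
  ≡⟨ ΣΣ-cong N (λ k l _ _ → *-distribʳ-+ (f k l) (𝟙 (k ≡ᵇ s)) (𝟙 (l ≡ᵇ t))) ⟩
    ΣΣ N (λ k l → 𝟙 (k ≡ᵇ s) * f k l + 𝟙 (l ≡ᵇ t) * f k l)
  ≡⟨ ΣΣ-distrib-+ N (λ k l → 𝟙 (k ≡ᵇ s) * f k l) (λ k l → 𝟙 (l ≡ᵇ t) * f k l) ⟩
    ΣΣ N (λ k l → 𝟙 (k ≡ᵇ s) * f k l) + ΣΣ N (λ k l → 𝟙 (l ≡ᵇ t) * f k l)
  ≡⟨ cong₂ _+_ (ΣΣ-pick-row s<N f) (ΣΣ-pick-column t<N f) ⟩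
    Σ< N (f s) + Σ< N (λ k → f k t)
  ∎

sumOver : {A : Set} → List A → (A → ℕ) → ℕ
sumOver xs f = sum (map f xs)

sumOver-++ : {A : Set} (xs ys : List A) (f : A → ℕ) → sumOver (xs ++ ys) f ≡ sumOver xs f + sumOver ys f
sumOver-++ xs ys f = trans (cong sum (map-++ f xs ys)) (sum-++ (map f xs) (map f ys))

sumOver-map : {A B : Set} (g : A → B) (xs : List A) (f : B → ℕ) → sumOver (map g xs) f ≡ sumOver xs (f ∘ g)
sumOver-map g []       f = refl
sumOver-map g (x ∷ xs) f = cong (_+_ (f (g x))) (sumOver-map g xs f)

sumOver-concatMap : {A B : Set} (g : A → List B) (xs : List A) (f : B → ℕ) →
  sumOver (concatMap g xs) f ≡ sumOver xs (λ x → sumOver (g x) f)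
sumOver-concatMap g []       f = refl
sumOver-concatMap g (x ∷ xs) f =
  trans (sumOver-++ (g x) (concatMap g xs) f) (cong (_+_ (sumOver (g x) f)) (sumOver-concatMap g xs f))

sumOver-applyUpTo : ∀ (g : ℕ → ℕ) N (f : ℕ → ℕ) → sumOver (applyUpTo g N) f ≡ Σ< N (f ∘ g)
sumOver-applyUpTo g zero    f = refl
sumOver-applyUpTo g (suc N) f = cong (_+_ (f (g 0))) (sumOver-applyUpTo (g ∘ suc) N f)

length-filter≡sumOver : {A : Set} {P : Pred A 0ℓ} (P? : Decidable P) (xs : List A) →
  length (filter P? xs) ≡ sumOver xs (𝟙 ∘ does ∘ P?)
length-filter≡sumOver P? []       = refl
length-filter≡sumOver P? (x ∷ xs) with does (P? x)
... | true  = cong suc (length-filter≡sumOver P? xs)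
... | false = length-filter≡sumOver P? xs

odd : ℕ → Bool
odd k = k % 2 ≡ᵇ 1

[m+2*k]%2≡m%2 : ∀ m k → (m + 2 * k) % 2 ≡ m % 2
[m+2*k]%2≡m%2 m k = trans (cong (λ x → (m + x) % 2) (*-comm 2 k)) ([m+kn]%n≡m%n m k 2)

[1+m]%2≢m%2 : ∀ m → suc m % 2 ≢ m % 2
[1+m]%2≢m%2 (suc (suc m)) eq = [1+m]%2≢m%2 m eq

∣m-n∣%2≡[m+n]%2 : ∀ m n → ℕ.∣ m - n ∣ % 2 ≡ (m + n) % 2
∣m-n∣%2≡[m+n]%2 zero    n       = refl
∣m-n∣%2≡[m+n]%2 (suc m) zero    = cong (λ x → suc x % 2) (sym (+-identityʳ m))
∣m-n∣%2≡[m+n]%2 (suc m) (suc n) = trans (∣m-n∣%2≡[m+n]%2 m n) (cong (λ x → suc x % 2) (sym (+-suc m n)))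

odd-2* : ∀ c → odd (2 * c) ≡ false
odd-2* c = cong (_≡ᵇ 1) ([m+2*k]%2≡m%2 0 c)

Σ<-odd-2* : ∀ c → Σ< (2 * c) (𝟙 ∘ odd) ≡ c
Σ<-odd-2* zero    = refl
Σ<-odd-2* (suc c) = trans (cong (λ M → Σ< M (𝟙 ∘ odd)) (*-suc 2 c)) (cong suc (Σ<-odd-2* c))

Σ<-odd-1+2* : ∀ c → Σ< (suc (2 * c)) (𝟙 ∘ odd) ≡ c
Σ<-odd-1+2* zero    = refl
Σ<-odd-1+2* (suc c) =
  trans (cong (λ M → Σ< (suc M) (𝟙 ∘ odd)) (*-suc 2 c)) (cong suc (Σ<-odd-1+2* c))

count-odd-<2* : ∀ {N} c → 2 * c ≤ N → Σ< N (λ k → 𝟙 ((k <ᵇ 2 * c) ∧ odd k)) ≡ c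
count-odd-<2* c 2c≤N = trans (Σ<-restrict 2c≤N odd) (Σ<-odd-2* c)

count-odd->2* : ∀ {m} c → c ≤ m → Σ< (suc (2 * m)) (λ k → 𝟙 ((2 * c <ᵇ k) ∧ odd k)) ≡ m ∸ c
count-odd->2* {m} c c≤m = begin
    Σ< N above              ≡⟨ sym (m+n∸n≡m (Σ< N above) c) ⟩
    Σ< N above + c ∸ c      ≡⟨ cong (_∸ c) above+c≡m ⟩
    m ∸ c                   ∎
  where
  N = suc (2 * m)
  above below : ℕ → ℕ
  above k = 𝟙 ((2 * c <ᵇ k) ∧ odd k)
  below k = 𝟙 ((k <ᵇ 2 * c) ∧ odd k)
  split : ∀ k → k < N → above k + below k ≡ 𝟙 (odd k)
  split k _ with <-cmp k (2 * c)
  ... | tri< k<2c _ ¬2c<k rewrite dec-false (2 * c <? k) ¬2c<k | dec-true (k <? 2 * c) k<2c = refl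
  ... | tri> ¬k<2c _ 2c<k rewrite dec-true (2 * c <? k) 2c<k | dec-false (k <? 2 * c) ¬k<2c = +-identityʳ _
  ... | tri≈ ¬k<2c refl _ rewrite dec-false (k <? k) ¬k<2c | odd-2* c = refl
  2c≤N : 2 * c ≤ N
  2c≤N = ≤-trans (*-monoʳ-≤ 2 c≤m) (n≤1+n _)
  above+c≡m : Σ< N above + c ≡ m
  above+c≡m = begin
    Σ< N above + c           ≡⟨ cong (_+_ (Σ< N above)) (sym (count-odd-<2* c 2c≤N)) ⟩
    Σ< N above + Σ< N below  ≡⟨ sym (Σ<-distrib-+ N above below) ⟩
    Σ< N (λ k → above k + below k) ≡⟨ Σ<-cong N split ⟩
    Σ< N (𝟙 ∘ odd)           ≡⟨ Σ<-odd-1+2* m ⟩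
    m                        ∎

admissible : ℕ → ℕ → Bool
admissible k l = (k <ᵇ l) ∧ odd (k + l)

count-admissible-from-2* : ∀ {m} c → c ≤ m → Σ< (suc (2 * m)) (λ l → 𝟙 (admissible (2 * c) l)) ≡ m ∸ c
count-admissible-from-2* {m} c c≤m = trans (Σ<-cong (suc (2 * m)) parity) (count-odd->2* c c≤m)
  where
  parity : ∀ l → l < suc (2 * m) → 𝟙 (admissible (2 * c) l) ≡ 𝟙 ((2 * c <ᵇ l) ∧ odd l)
  parity l _ = cong (λ x → 𝟙 ((2 * c <ᵇ l) ∧ (x ≡ᵇ 1)))
                    (trans (cong (_% 2) (+-comm (2 * c) l)) ([m+2*k]%2≡m%2 l c))

count-admissible-to-2* : ∀ {N} c → 2 * c ≤ N → Σ< N (λ k → 𝟙 (admissible k (2 * c))) ≡ c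
count-admissible-to-2* {N} c 2c≤N = trans (Σ<-cong N parity) (count-odd-<2* c 2c≤N)
  where
  parity : ∀ k → k < N → 𝟙 (admissible k (2 * c)) ≡ 𝟙 ((k <ᵇ 2 * c) ∧ odd k)
  parity k _ = cong (λ x → 𝟙 ((k <ᵇ 2 * c) ∧ (x ≡ᵇ 1))) ([m+2*k]%2≡m%2 k c)

rangeAt : ℕ → ℕ → ℤ
rangeAt n k = + k - + n

rangeAt-+n : ∀ n k → rangeAt n k ℤ.+ + n ≡ + k
rangeAt-+n n k = cancel (+ k) (+ n)
  where
  cancel : ∀ a b → (a - b) ℤ.+ b ≡ a
  cancel = ℤ-Solver.solve-∀

rangeAt-injective : ∀ n {k l} → rangeAt n k ≡ rangeAt n l → k ≡ l
rangeAt-injective n {k} {l} eq =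
  ℤₚ.+-injective (trans (sym (rangeAt-+n n k)) (trans (cong (ℤ._+ + n) eq) (rangeAt-+n n l)))

rangeAt-<ᵇ : ∀ n k l → does (rangeAt n k ℤ.<? rangeAt n l) ≡ (k <ᵇ l)
rangeAt-<ᵇ n k l = does-⇔ (mk⇔ from to) (rangeAt n k ℤ.<? rangeAt n l) (k <? l)
  where
  from : rangeAt n k ℤ.< rangeAt n l → k < l
  from lt = ℤₚ.drop‿+<+ (subst₂ ℤ._<_ (rangeAt-+n n k) (rangeAt-+n n l) (ℤₚ.+-monoˡ-< (+ n) lt))
  to : k < l → rangeAt n k ℤ.< rangeAt n l
  to lt = ℤₚ.+-monoˡ-< (- + n) (ℤ.+<+ lt)

rangeAt-odd : ∀ n k l → does (∣ rangeAt n k - rangeAt n l ∣ % 2 ≟ 1) ≡ odd (k + l)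
rangeAt-odd n k l = cong (_≡ᵇ 1) (begin
    ∣ rangeAt n k - rangeAt n l ∣ % 2  ≡⟨ cong (λ x → ∣ x ∣ % 2) (shift (+ k) (+ l) (+ n)) ⟩
    ∣ + k - + l ∣ % 2                  ≡⟨ cong (λ x → ∣ x ∣ % 2) (ℤₚ.m-n≡m⊖n k l) ⟩
    ∣ k ⊖ l ∣ % 2                      ≡⟨ cong (_% 2) (∣m⊖n∣≡∣m-n∣ k l) ⟩
    ℕ.∣ k - l ∣ % 2                    ≡⟨ ∣m-n∣%2≡[m+n]%2 k l ⟩
    (k + l) % 2                        ∎)
  where
  shift : ∀ a b c → (a - c) - (b - c) ≡ a - b
  shift = ℤ-Solver.solve-∀
  ∣m⊖n∣≡∣m-n∣ : ∀ m n → ∣ m ⊖ n ∣ ≡ ℕ.∣ m - n ∣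
  ∣m⊖n∣≡∣m-n∣ zero    zero    = refl
  ∣m⊖n∣≡∣m-n∣ zero    (suc n) = refl
  ∣m⊖n∣≡∣m-n∣ (suc m) zero    = refl
  ∣m⊖n∣≡∣m-n∣ (suc m) (suc n) = trans (cong ∣_∣ (ℤₚ.[1+m]⊖[1+n]≡m⊖n m n)) (∣m⊖n∣≡∣m-n∣ m n)

rangeAt-≟ : ∀ n k {t x} → rangeAt n t ≡ x → does (rangeAt n k ℤ.≟ x) ≡ (k ≡ᵇ t)
rangeAt-≟ n k {t} {x} eq = does-⇔ (mk⇔ (λ k≡x → rangeAt-injective n (trans k≡x (sym eq)))
                                        (λ k≡t → trans (cong (rangeAt n) k≡t) eq))
                                   (rangeAt n k ℤ.≟ x) (k ≟ t)

rangeAt-n+p : ∀ n p → rangeAt n (n + p) ≡ + p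
rangeAt-n+p n p = trans (cong (ℤ._- + n) (ℤₚ.pos-+ n p)) (cancel (+ n) (+ p))
  where
  cancel : ∀ a b → (a ℤ.+ b) - a ≡ b
  cancel = ℤ-Solver.solve-∀

rangeAt-inRange : ∀ n {k} → k < suc (2 * n) → InRange n (rangeAt n k)
rangeAt-inRange n {k} (s≤s k≤2n) = lower , upper
  where
  lower : - + n ℤ.≤ rangeAt n k
  lower = subst (ℤ._≤ rangeAt n k) (ℤₚ.+-identityˡ (- + n)) (ℤₚ.+-monoˡ-≤ (- + n) (ℤ.+≤+ z≤n))
  upper : rangeAt n k ℤ.≤ + n
  upper = subst (rangeAt n k ℤ.≤_) (rangeAt-n+p n n)
                (ℤₚ.+-monoˡ-≤ (- + n) (ℤ.+≤+ (subst (k ≤_) (cong (_+_ n) (+-identityʳ n)) k≤2n)))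

rangeAt-p+m : ∀ p m → rangeAt (p + m) m ≡ - + p
rangeAt-p+m p m = trans (cong (λ x → + m - x) (ℤₚ.pos-+ p m)) (cancel (+ p) (+ m))
  where
  cancel : ∀ a b → b - (a ℤ.+ b) ≡ - a
  cancel = ℤ-Solver.solve-∀

inversion : (ℤ → ℤ) → ℤ → ℤ → Bool
inversion v i j = does (i ℤ.<? j) ∧ (does (v j ℤ.<? v i) ∧ does (∣ i - j ∣ % 2 ≟ 1))

length-invPairs : ∀ n v →
  length (invPairs n v) ≡ ΣΣ (suc (2 * n)) (λ k l → 𝟙 (inversion v (rangeAt n k) (rangeAt n l)))
length-invPairs n v = begin
    length (invPairs n v)
  ≡⟨ length-filter≡sumOver _ pairs ⟩
    sumOver pairs (λ ij → 𝟙 (inversion v (proj₁ ij) (proj₂ ij)))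
  ≡⟨ sumOver-concatMap (λ i → map (i ,_) (range n)) (range n) _ ⟩
    sumOver (range n) (λ i → sumOver (map (i ,_) (range n)) (λ ij → 𝟙 (inversion v (proj₁ ij) (proj₂ ij))))
  ≡⟨ cong sum (map-cong (λ i → trans (sumOver-map (i ,_) (range n) _) (sumOver-range _)) (range n)) ⟩
    sumOver (range n) (λ i → Σ< N (λ l → 𝟙 (inversion v i (rangeAt n l))))
  ≡⟨ sumOver-range (λ i → Σ< N (λ l → 𝟙 (inversion v i (rangeAt n l)))) ⟩
    ΣΣ N (λ k l → 𝟙 (inversion v (rangeAt n k) (rangeAt n l)))
  ∎
  where
  N = suc (2 * n)
  pairs = concatMap (λ i → map (i ,_) (range n)) (range n)
  sumOver-range : (f : ℤ → ℕ) → sumOver (range n) f ≡ Σ< N (f ∘ rangeAt n)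
  sumOver-range f = trans (sumOver-map (rangeAt n) (upTo N) f) (sumOver-applyUpTo (λ k → k) N _)

flipAt-≡ : ∀ {p} w {i} → ∣ i ∣ ≡ p → flipAt p w i ≡ - w i
flipAt-≡ {p} w {i} ∣i∣≡p = cong (λ b → if b then - w i else w i) (dec-true (∣ i ∣ ≟ p) ∣i∣≡p)

flipAt-≢ : ∀ {p} w {i} → ∣ i ∣ ≢ p → flipAt p w i ≡ w i
flipAt-≢ {p} w {i} ∣i∣≢p = cong (λ b → if b then - w i else w i) (dec-false (∣ i ∣ ≟ p) ∣i∣≢p)

∣i∣≢p : ∀ {i p} → i ≢ + p → i ≢ - + p → ∣ i ∣ ≢ p
∣i∣≢p {+ _}       i≢p _    refl = i≢p refl
∣i∣≢p { -[1+ _ ]} _   i≢-p refl = i≢-p refl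

∣-p-p∣%2≡0 : ∀ p → ∣ - + p - + p ∣ % 2 ≡ 0
∣-p-p∣%2≡0 zero    = refl
∣-p-p∣%2≡0 (suc q) = trans (cong (λ x → (q + x) % 2) (sym (+-identityʳ q))) ([m+2*k]%2≡m%2 0 q)

module _ {n p : ℕ} {w : ℤ → ℤ} (w∈B : IsB n w) (1≤p : 1 ≤ p) (p≤n : p ≤ n)
         (w[p]≡-n : w (+ p) ≡ - + n) where

  private
    w-range : ∀ i → InRange n i → InRange n (w i)
    w-range = proj₁ (proj₂ w∈B)

    w-injective : ∀ i j → InRange n i → InRange n j → w i ≡ w j → i ≡ j
    w-injective = proj₁ (proj₂ (proj₂ w∈B))

    w[-p]≡n : w (- + p) ≡ + n
    w[-p]≡n = trans (proj₁ w∈B (+ p)) (trans (cong -_ w[p]≡-n) (ℤₚ.neg-involutive (+ n)))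

    +p∈ : InRange n (+ p)
    +p∈ = ℤₚ.neg-≤-pos , ℤ.+≤+ p≤n

    -p∈ : InRange n (- + p)
    -p∈ = ℤₚ.neg-mono-≤ (ℤ.+≤+ p≤n) , ℤₚ.≤-trans ℤₚ.neg-≤-pos (ℤ.+≤+ z≤n)

    +p≢-p : + p ≢ - + p
    +p≢-p = positive≢negated 1≤p
      where
      positive≢negated : ∀ {m} → 1 ≤ m → + m ≢ - + m
      positive≢negated (s≤s _) ()

    w<n : ∀ {j} → InRange n j → j ≢ - + p → w j ℤ.< + n
    w<n {j} j∈ j≢-p = ℤₚ.≤∧≢⇒< (proj₂ (w-range j j∈))
      (λ wj≡n → j≢-p (w-injective j (- + p) j∈ -p∈ (trans wj≡n (sym w[-p]≡n))))

    -n<w : ∀ {j} → InRange n j → j ≢ + p → - + n ℤ.< w j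
    -n<w {j} j∈ j≢p = ℤₚ.≤∧≢⇒< (proj₁ (w-range j j∈))
      (λ -n≡wj → j≢p (w-injective j (+ p) j∈ +p∈ (trans (sym -n≡wj) (sym w[p]≡-n))))

    w≮-n : ∀ {j} → InRange n j → ¬ (w j ℤ.< - + n)
    w≮-n {j} j∈ = ℤₚ.≤⇒≯ (proj₁ (w-range j j∈))

    n≮w : ∀ {j} → InRange n j → ¬ (+ n ℤ.< w j)
    n≮w {j} j∈ = ℤₚ.≤⇒≯ (proj₂ (w-range j j∈))

  descent-flipAt-balance : ∀ {i j} → InRange n i → InRange n j → i ℤ.< j → ∣ i - j ∣ % 2 ≡ 1 →
      𝟙 (does (w j ℤ.<? w i)) + (𝟙 (does (i ℤ.≟ + p)) + 𝟙 (does (j ℤ.≟ - + p)))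
    ≡ 𝟙 (does (flipAt p w j ℤ.<? flipAt p w i)) + (𝟙 (does (i ℤ.≟ - + p)) + 𝟙 (does (j ℤ.≟ + p)))
  descent-flipAt-balance {i} {j} i∈ j∈ i<j odd with i ℤ.≟ + p | i ℤ.≟ - + p | j ℤ.≟ + p | j ℤ.≟ - + p
  ... | yes refl | yes p≡-p | _        | _        = ⊥-elim (+p≢-p p≡-p)
  ... | yes refl | no _     | yes refl | _        = ⊥-elim (ℤₚ.<-irrefl refl i<j)
  ... | yes refl | no _     | no _     | yes refl = ⊥-elim (ℤₚ.<⇒≱ i<j ℤₚ.neg-≤-pos)
  ... | yes refl | no _     | no j≢p   | no j≢-p
    rewrite flipAt-≡ w {+ p} refl | flipAt-≢ w {j} (∣i∣≢p j≢p j≢-p) | w[p]≡-n | ℤₚ.neg-involutive (+ n)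
          | dec-false (w j ℤ.<? - + n) (w≮-n j∈) | dec-true (w j ℤ.<? + n) (w<n j∈ j≢-p) = refl
  ... | no _     | yes refl | _        | yes refl = ⊥-elim (ℤₚ.<-irrefl refl i<j)
  ... | no _     | yes refl | yes refl | no _     = ⊥-elim (1+n≢0 (trans (sym odd) (∣-p-p∣%2≡0 p)))
  ... | no _     | yes refl | no j≢p   | no j≢-p
    rewrite flipAt-≡ w { - + p} (ℤₚ.∣-i∣≡∣i∣ (+ p)) | flipAt-≢ w {j} (∣i∣≢p j≢p j≢-p) | w[-p]≡n
          | dec-true (w j ℤ.<? + n) (w<n j∈ j≢-p) | dec-false (w j ℤ.<? - + n) (w≮-n j∈) = refl
  ... | no _     | no _     | yes refl | yes p≡-p = ⊥-elim (+p≢-p p≡-p)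
  ... | no i≢p   | no i≢-p  | yes refl | no _
    rewrite flipAt-≡ w {+ p} refl | flipAt-≢ w {i} (∣i∣≢p i≢p i≢-p) | w[p]≡-n | ℤₚ.neg-involutive (+ n)
          | dec-true (- + n ℤ.<? w i) (-n<w i∈ i≢p) | dec-false (+ n ℤ.<? w i) (n≮w i∈) = refl
  ... | no i≢p   | no i≢-p  | no _     | yes refl
    rewrite flipAt-≡ w { - + p} (ℤₚ.∣-i∣≡∣i∣ (+ p)) | flipAt-≢ w {i} (∣i∣≢p i≢p i≢-p) | w[-p]≡n
          | dec-false (+ n ℤ.<? w i) (n≮w i∈) | dec-true (- + n ℤ.<? w i) (-n<w i∈ i≢p) = refl
  ... | no i≢p   | no i≢-p  | no j≢p   | no j≢-p
    rewrite flipAt-≢ w {i} (∣i∣≢p i≢p i≢-p) | flipAt-≢ w {j} (∣i∣≢p j≢p j≢-p) = refl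

from-does : ∀ {A : Set} (a? : Dec A) → does a? ≡ true → A
from-does (yes a) _ = a
from-does (no _)  ()

count-through-ends : ∀ {n} a b → n ≡ a + b →
  ΣΣ (suc (2 * n)) (λ k l → (𝟙 (k ≡ᵇ 2 * a) + 𝟙 (l ≡ᵇ 2 * b)) * 𝟙 (admissible k l)) ≡ b + b
count-through-ends {n} a b n≡a+b = begin
    ΣΣ N (λ k l → (𝟙 (k ≡ᵇ 2 * a) + 𝟙 (l ≡ᵇ 2 * b)) * 𝟙 (admissible k l))
  ≡⟨ ΣΣ-row+column (2*<N a≤n) (2*<N b≤n) (λ k l → 𝟙 (admissible k l)) ⟩
    Σ< N (λ l → 𝟙 (admissible (2 * a) l)) + Σ< N (λ k → 𝟙 (admissible k (2 * b)))
  ≡⟨ cong₂ _+_ (count-admissible-from-2* a a≤n) (count-admissible-to-2* b (<⇒≤ (2*<N b≤n))) ⟩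
    n ∸ a + b
  ≡⟨ cong (λ m → m ∸ a + b) n≡a+b ⟩
    a + b ∸ a + b
  ≡⟨ cong (_+ b) (m+n∸m≡n a b) ⟩
    b + b
  ∎
  where
  N = suc (2 * n)
  a≤n : a ≤ n
  a≤n = subst (a ≤_) (sym n≡a+b) (m≤m+n a b)
  b≤n : b ≤ n
  b≤n = subst (b ≤_) (sym n≡a+b) (m≤n+m b a)
  2*<N : ∀ {c} → c ≤ n → 2 * c < N
  2*<N c≤n = s≤s (*-monoʳ-≤ 2 c≤n)

length-invPairs-flipAt : ∀ {n p b} {w : ℤ → ℤ} → IsB n w → 1 ≤ p → n ≡ p + 2 * b → w (+ p) ≡ - + n →
  length (invPairs n w) ≡ length (invPairs n (flipAt p w)) + p * 2
length-invPairs-flipAt {n} {p} {b} {w} w∈B 1≤p n≡p+2b w[p]≡-n = +-cancelʳ-≡ (b + b) _ _ (begin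
    length (invPairs n w) + (b + b)          ≡⟨ cong₂ _+_ (length-invPairs n w) (sym #gained) ⟩
    ΣΣ N (inv w) + ΣΣ N gained               ≡⟨ sym (ΣΣ-distrib-+ N (inv w) gained) ⟩
    ΣΣ N (λ k l → inv w k l + gained k l)    ≡⟨ ΣΣ-cong N balance ⟩
    ΣΣ N (λ k l → inv u k l + lost k l)      ≡⟨ ΣΣ-distrib-+ N (inv u) lost ⟩
    ΣΣ N (inv u) + ΣΣ N lost                 ≡⟨ cong₂ _+_ (sym (length-invPairs n u)) #lost ⟩
    length (invPairs n u) + (a + a)          ≡⟨ regroup (length (invPairs n u)) p b ⟩
    length (invPairs n u) + p * 2 + (b + b)  ∎)
  where
  u = flipAt p w
  a = p + b
  N = suc (2 * n)
  t₊ = 2 * a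
  t₋ = 2 * b

  n≡a+b : n ≡ a + b
  n≡a+b = trans n≡p+2b (reassociate p b)
    where
    reassociate : ∀ p b → p + 2 * b ≡ p + b + b
    reassociate = solve-∀

  rangeAt-t₊ : rangeAt n t₊ ≡ + p
  rangeAt-t₊ = trans (cong (rangeAt n) (trans (double p b) (cong (_+ p) (sym n≡p+2b)))) (rangeAt-n+p n p)
    where
    double : ∀ p b → 2 * (p + b) ≡ p + 2 * b + p
    double = solve-∀

  rangeAt-t₋ : rangeAt n t₋ ≡ - + p
  rangeAt-t₋ = subst (λ m → rangeAt m t₋ ≡ - + p) (sym n≡p+2b) (rangeAt-p+m p t₋)

  inv : (ℤ → ℤ) → ℕ → ℕ → ℕ
  inv v k l = 𝟙 (inversion v (rangeAt n k) (rangeAt n l))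

  gained lost : ℕ → ℕ → ℕ
  gained k l = (𝟙 (k ≡ᵇ t₊) + 𝟙 (l ≡ᵇ t₋)) * 𝟙 (admissible k l)
  lost   k l = (𝟙 (k ≡ᵇ t₋) + 𝟙 (l ≡ᵇ t₊)) * 𝟙 (admissible k l)

  #gained : ΣΣ N gained ≡ b + b
  #gained = count-through-ends a b n≡a+b

  #lost : ΣΣ N lost ≡ a + a
  #lost = count-through-ends b a (trans n≡a+b (+-comm a b))

  balance : ∀ k l → k < N → l < N → inv w k l + gained k l ≡ inv u k l + lost k l
  balance k l k<N l<N = begin
      inv w k l + gained k l
    ≡⟨ cong (_+ gained k l) (reindex w) ⟩
      𝟙 ((k <ᵇ l) ∧ (descent w ∧ odd (k + l))) + gained k l
    ≡⟨ 𝟙-guarded (k <ᵇ l) (odd (k + l)) _ _ _ _ balanced ⟩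
      𝟙 ((k <ᵇ l) ∧ (descent u ∧ odd (k + l))) + lost k l
    ≡⟨ cong (_+ lost k l) (sym (reindex u)) ⟩
      inv u k l + lost k l
    ∎
    where
    i = rangeAt n k
    j = rangeAt n l
    descent : (ℤ → ℤ) → Bool
    descent v = does (v j ℤ.<? v i)
    reindex : ∀ v → inv v k l ≡ 𝟙 ((k <ᵇ l) ∧ (descent v ∧ odd (k + l)))
    reindex v = cong₂ (λ x y → 𝟙 (x ∧ (descent v ∧ y))) (rangeAt-<ᵇ n k l) (rangeAt-odd n k l)
    at± : ∀ m → 𝟙 (does (rangeAt n m ℤ.≟ + p)) ≡ 𝟙 (m ≡ᵇ t₊)
              × 𝟙 (does (rangeAt n m ℤ.≟ - + p)) ≡ 𝟙 (m ≡ᵇ t₋)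
    at± m = cong 𝟙 (rangeAt-≟ n m rangeAt-t₊) , cong 𝟙 (rangeAt-≟ n m rangeAt-t₋)
    balanced : (k <ᵇ l) ≡ true → odd (k + l) ≡ true →
        𝟙 (descent w) + (𝟙 (k ≡ᵇ t₊) + 𝟙 (l ≡ᵇ t₋))
      ≡ 𝟙 (descent u) + (𝟙 (k ≡ᵇ t₋) + 𝟙 (l ≡ᵇ t₊))
    balanced k<l odd[k+l] = begin
        𝟙 (descent w) + (𝟙 (k ≡ᵇ t₊) + 𝟙 (l ≡ᵇ t₋))
      ≡⟨ cong (_+_ (𝟙 (descent w))) (sym (cong₂ _+_ (proj₁ (at± k)) (proj₂ (at± l)))) ⟩
        𝟙 (descent w) + (𝟙 (does (i ℤ.≟ + p)) + 𝟙 (does (j ℤ.≟ - + p)))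
      ≡⟨ descent-flipAt-balance w∈B 1≤p (subst (p ≤_) (sym n≡p+2b) (m≤m+n p (2 * b))) w[p]≡-n
           (rangeAt-inRange n k<N) (rangeAt-inRange n l<N)
           (from-does (i ℤ.<? j) (trans (rangeAt-<ᵇ n k l) k<l))
           (from-does (∣ i - j ∣ % 2 ≟ 1) (trans (rangeAt-odd n k l) odd[k+l])) ⟩
        𝟙 (descent u) + (𝟙 (does (i ℤ.≟ - + p)) + 𝟙 (does (j ℤ.≟ + p)))
      ≡⟨ cong (_+_ (𝟙 (descent u))) (cong₂ _+_ (proj₂ (at± k)) (proj₁ (at± l))) ⟩
        𝟙 (descent u) + (𝟙 (k ≡ᵇ t₋) + 𝟙 (l ≡ᵇ t₊))
      ∎

  regroup : ∀ x p b → x + ((p + b) + (p + b)) ≡ x + p * 2 + (b + b)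
  regroup = solve-∀

odd-gap : ∀ {m n} → m ≤ n → (n ∸ m) % 2 ≡ 1 → n ≡ suc m + 2 * ((n ∸ m) / 2)
odd-gap {m} {n} m≤n gap-odd = begin
    n                          ≡⟨ sym (m+[n∸m]≡n m≤n) ⟩
    m + (n ∸ m)                ≡⟨ cong (_+_ m) (m≡m%n+[m/n]*n (n ∸ m) 2) ⟩
    m + ((n ∸ m) % 2 + q * 2)  ≡⟨ cong (λ r → m + (r + q * 2)) gap-odd ⟩
    m + (1 + q * 2)            ≡⟨ regroup m q ⟩
    suc m + 2 * q              ∎
  where
  q = (n ∸ m) / 2
  regroup : ∀ m q → m + (1 + q * 2) ≡ suc m + 2 * q
  regroup = solve-∀

IsC⇒w[m]≢n : ∀ {n m q} {w : ℤ → ℤ} → IsC n w → m ≤ n → n ≡ suc m + 2 * q → w (+ m) ≢ + n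
IsC⇒w[m]≢n {n} {m} {q} {w} (_ , w-parity) m≤n n≡1+m+2q w[m]≡n = [1+m]%2≢m%2 m (begin
    suc m % 2            ≡⟨ sym ([m+2*k]%2≡m%2 (suc m) q) ⟩
    (suc m + 2 * q) % 2  ≡⟨ cong (_% 2) (sym n≡1+m+2q) ⟩
    n % 2                ≡⟨ cong (λ x → ∣ x ∣ % 2) (sym w[m]≡n) ⟩
    ∣ w (+ m) ∣ % 2      ≡⟨ w-parity (+ m) (ℤₚ.neg-≤-pos , ℤ.+≤+ m≤n) ⟩
    m % 2                ∎)

lemma7p1 : (n : ℕ) → 1 ≤ n → (I : ℕ → Set) → (∀ i → I i → i < n) →
    (im : ℕ) → IsIm n I im → (n ∸ im) % 2 ≡ 1 →
    (w : ℤ → ℤ) → IsCIk n I im w →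
    L n (flipAt (suc im) w) + im + 1 ≡ L n w
lemma7p1 n _ I I<n im (im∈I , _) gap-odd w ((w∈C , _) , extreme) = case extreme of λ where
    (inj₁ w[im]≡n)     → ⊥-elim (IsC⇒w[m]≢n {q = q} w∈C im≤n n≡1+im+2q w[im]≡n)
    (inj₂ w[1+im]≡-n) → begin
        L n u + im + 1
      ≡⟨ trans (+-assoc (L n u) im 1) (cong (_+_ (L n u)) (+-comm im 1)) ⟩
        L n u + suc im
      ≡⟨ cong (_+_ (L n u)) (sym (m*n/n≡m (suc im) 2)) ⟩
        L n u + suc im * 2 / 2
      ≡⟨ sym (+-distrib-/-∣ʳ (length (invPairs n u)) (divides (suc im) refl)) ⟩
        (length (invPairs n u) + suc im * 2) / 2
      ≡⟨ cong (_/ 2) (sym (length-invPairs-flipAt {b = q} (proj₁ w∈C) (s≤s z≤n) n≡1+im+2q w[1+im]≡-n)) ⟩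
        L n w
      ∎
  where
  u = flipAt (suc im) w
  q = (n ∸ im) / 2
  im≤n = <⇒≤ (I<n im im∈I)
  n≡1+im+2q = odd-gap im≤n gap-odd
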